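{- Let $L$ be a finite extension of $k=\mathbb{F}_q(\theta)$ with $k\subset L\subset\overline{k}$. Let $E=(\mathbb{G}_{a/L},\phi)$ be a Drinfeld $\mathbb{F}_q[t]$-module over $L$ with $\phi_t=\theta+\kappa_1\tau+\cdots+\kappa_r\tau^r\in L[\tau]$, $r\ge1$, $\kappa_r\ne0$, and let $P_1,\dots,P_\ell\in E(L)=L$. Let $a_1,\dots,a_\ell\in\mathbb{F}_q[t]$ and set $F=a_1P_1+\cdots+a_\ell P_\ell\in L[t]$. Then the following are equivalent: (1) $\phi_{a_1}(P_1)+\cdots+\phi_{a_\ell}(P_\ell)=0$; (2) there exists $g\in L[t]$ such that $(t-\theta)g+F=\kappa_rg^{(r)}+\cdots+\kappa_1g^{(1)}$.
   Context: $\tau$ is the $q$-th power Frobenius and $L[\tau]$ the twisted polynomial ring with $\tau\alpha=\alpha^q\tau$; $\phi_a$ acts on $L$ as an additive polynomial. For $g=\sum_i g_it^i\in L[t]$ and $n\ge0$, $g^{(n)}=\sum_i g_i^{q^n}t^i$ (Frobenius twist of coefficients only). -}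

module Defs where

open import Level using (_⊔_)
open import Algebra.Bundles using (CommutativeRing)
open import Data.Nat as ℕ using (ℕ; zero; suc)
open import Data.Fin using (Fin)
open import Data.List using (List; []; _∷_; map)
open import Data.List.Relation.Unary.All using (All)
open import Data.Product using (_×_; ∃; Σ)
open import Function using (_∘_)
open import Relation.Nullary using (¬_)
open import Relation.Binary.PropositionalEquality using (_≡_)

module _ {c ℓ} (L : CommutativeRing c ℓ) where
  open CommutativeRing L renaming (Carrier to A)

  pow : A → ℕ → A
  pow x zero = 1#
  pow x (suc n) = x * pow x n

  sumFin : ∀ {n} → (Fin n → A) → A
  sumFin {zero} f = 0#
  sumFin {suc n} f = f Fin.zero + sumFin (f ∘ Fin.suc)

  sum1to : ℕ → (ℕ → A) → A
  sum1to zero f = 0#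
  sum1to (suc r) f = sum1to r f + f (suc r)

  IsField : Set (c ⊔ ℓ)
  IsField = (¬ (1# ≈ 0#)) × (∀ x → ¬ (x ≈ 0#) → ∃ λ y → x * y ≈ 1#)

  natToL : ℕ → A
  natToL zero = 0#
  natToL (suc n) = 1# + natToL n

  InFq : ℕ → A → Set ℓ
  InFq q x = pow x q ≈ x

  -- L contains q distinct elements of F_q, i.e. F_q ⊆ L
  ContainsFq : ℕ → Set (c ⊔ ℓ)
  ContainsFq q = Σ (Fin q → A) λ e →
    (∀ i → InFq q (e i)) × (∀ i j → e i ≈ e j → i ≡ j)

  -- Polynomials in t over L: coefficient lists, lowest degree first.
  Poly : Set c
  Poly = List A

  coeff : Poly → ℕ → A
  coeff [] n = 0#
  coeff (x ∷ f) zero = x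
  coeff (x ∷ f) (suc n) = coeff f n

  -- equality of polynomials (coefficientwise; trailing zeros irrelevant)
  _≈ₚ_ : Poly → Poly → Set ℓ
  f ≈ₚ g = ∀ n → coeff f n ≈ coeff g n

  FqPoly : ℕ → Poly → Set (c ⊔ ℓ)
  FqPoly q f = All (InFq q) f

  evalPoly : Poly → A → A
  evalPoly [] x = 0#
  evalPoly (c₀ ∷ f) x = c₀ + x * evalPoly f x

  addP : Poly → Poly → Poly
  addP [] g = g
  addP (x ∷ f) [] = x ∷ f
  addP (x ∷ f) (y ∷ g) = (x + y) ∷ addP f g

  scaleP : A → Poly → Poly
  scaleP a f = map (a *_) f

  -- multiplication by t
  shiftP : Poly → Poly
  shiftP f = 0# ∷ f

  -- Frobenius twist g^{(n)}: raise coefficients to the q^n-th power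
  twistP : ℕ → ℕ → Poly → Poly
  twistP q n f = map (λ x → pow x (q ℕ.^ n)) f

  sumFinP : ∀ {n} → (Fin n → Poly) → Poly
  sumFinP {zero} f = []
  sumFinP {suc n} f = addP (f Fin.zero) (sumFinP (f ∘ Fin.suc))

  sum1toP : ℕ → (ℕ → Poly) → Poly
  sum1toP zero f = []
  sum1toP (suc r) f = addP (sum1toP r f) (f (suc r))

  Transcendental : ℕ → A → Set (c ⊔ ℓ)
  Transcendental q θ = ∀ f → FqPoly q f → evalPoly f θ ≈ 0# → f ≈ₚ []

  -- L is a finite extension of F_q(θ): finitely many b_1..b_n span L over F_q(θ),
  -- i.e. every x is Σ (f_i(θ)/d(θ)) b_i with f_i, d ∈ F_q[t], d(θ) ≠ 0.
  FiniteOverFqθ : ℕ → A → Set (c ⊔ ℓ)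
  FiniteOverFqθ q θ = Σ ℕ λ n → Σ (Fin n → A) λ b → ∀ x →
    Σ Poly λ d → Σ (Fin n → Poly) λ f →
      FqPoly q d × (¬ (evalPoly d θ ≈ 0#)) × (∀ i → FqPoly q (f i)) ×
      (x * evalPoly d θ ≈ sumFin (λ i → evalPoly (f i) θ * b i))

  phiT : ℕ → A → ℕ → (ℕ → A) → A → A
  phiT q θ r κ x = θ * x + sum1to r (λ j → κ j * pow x (q ℕ.^ j))

  phiA : ℕ → A → ℕ → (ℕ → A) → Poly → A → A
  phiA q θ r κ [] x = 0#
  phiA q θ r κ (a₀ ∷ a) x = a₀ * x + phiT q θ r κ (phiA q θ r κ a x)

{-# OPTIONS --safe #-}
module Submission where

open import Defs
open import Algebra.Bundles using (CommutativeRing)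
open import Data.Nat using (ℕ; suc; _^_; _≤_)
open import Data.Nat.Primality using (Prime)
open import Data.Fin using (Fin)
open import Data.Product using (∃)
open import Function.Bundles using (_⇔_)
open import Relation.Nullary using (¬_)
open import Relation.Binary.PropositionalEquality using (_≡_)

open import Data.Nat as ℕ using (zero; _<_; z≤n; s≤s)
open import Data.Nat.Properties as ℕ using ()
open import Data.Nat.Combinatorics using (_C_; nCn≡1; nC1≡n; nCk+nC[k+1]≡[n+1]C[k+1])
open import Data.Nat.Divisibility using (_∣_; divides; ∣⇒≤)
open import Data.Nat.Primality using (euclidsLemma)
open import Data.Nat.Solver using (module +-*-Solver)
open import Data.Fin as Fin using (toℕ; fromℕ)
open import Data.Fin.Properties using (toℕ-fromℕ)
open import Data.List using ([]; _∷_; map)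
open import Data.Product using (_,_; map₂)
open import Data.Sum using (inj₁; inj₂)
open import Data.Empty using (⊥-elim)
open import Function using (_∘_; Equivalence; mk⇔)
import Relation.Binary.PropositionalEquality as ≡

-- The Frobenius x ↦ x^q is additive, hence so is φ_t.  Let ⟨F⟩ = Σ_n φ_t^n(F_n) be the
-- action of F ∈ L[t] on E, so that condition (1) reads ⟨F⟩ = 0.  Comparing coefficients,
-- condition (2) says F + t·g = φ_t∘g, where φ_t∘g applies φ_t to each coefficient, i.e.
-- F_n + g_{n−1} = φ_t(g_n).  As ⟨t·g⟩ = φ_t⟨g⟩ = ⟨φ_t∘g⟩, (2) gives ⟨F⟩ = 0; conversely,
-- if ⟨F⟩ = 0 then g_n = −⟨F_{n+1} + F_{n+2} t + ⋯⟩ solves (2).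

[1+k]*[1+n]C[1+k]≡[1+n]*nCk : ∀ n k → suc k ℕ.* (suc n C suc k) ≡ suc n ℕ.* (n C k)
[1+k]*[1+n]C[1+k]≡[1+n]*nCk zero zero = ≡.refl
[1+k]*[1+n]C[1+k]≡[1+n]*nCk zero (suc k) = ℕ.*-zeroʳ (suc (suc k))
[1+k]*[1+n]C[1+k]≡[1+n]*nCk (suc n) zero =
  ≡.trans (ℕ.+-identityʳ _) (≡.trans (nC1≡n (suc (suc n))) (≡.sym (ℕ.*-identityʳ (suc (suc n)))))
[1+k]*[1+n]C[1+k]≡[1+n]*nCk (suc n) (suc k) = begin
  suc (suc k) ℕ.* (suc (suc n) C suc (suc k))
    ≡⟨ ≡.cong (suc (suc k) ℕ.*_) (pascal (suc n) (suc k)) ⟩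
  suc (suc k) ℕ.* ((suc n C suc k) ℕ.+ (suc n C suc (suc k)))
    ≡⟨ solve 3 (λ k a b → (con 1 :+ (con 1 :+ k)) :* (a :+ b)
                         := a :+ (con 1 :+ k) :* a :+ (con 1 :+ (con 1 :+ k)) :* b)
             ≡.refl k (suc n C suc k) (suc n C suc (suc k)) ⟩
  (suc n C suc k) ℕ.+ suc k ℕ.* (suc n C suc k) ℕ.+ suc (suc k) ℕ.* (suc n C suc (suc k))
    ≡⟨ ≡.cong₂ (λ u v → (suc n C suc k) ℕ.+ u ℕ.+ v)
               ([1+k]*[1+n]C[1+k]≡[1+n]*nCk n k) ([1+k]*[1+n]C[1+k]≡[1+n]*nCk n (suc k)) ⟩
  (suc n C suc k) ℕ.+ suc n ℕ.* (n C k) ℕ.+ suc n ℕ.* (n C suc k)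
    ≡⟨ solve 4 (λ c n a b → c :+ (con 1 :+ n) :* a :+ (con 1 :+ n) :* b
                           := c :+ (con 1 :+ n) :* (a :+ b))
             ≡.refl (suc n C suc k) n (n C k) (n C suc k) ⟩
  (suc n C suc k) ℕ.+ suc n ℕ.* ((n C k) ℕ.+ (n C suc k))
    ≡⟨ ≡.cong (λ u → (suc n C suc k) ℕ.+ suc n ℕ.* u) (≡.sym (pascal n k)) ⟩
  suc (suc n) ℕ.* (suc n C suc k) ∎
  where
  open ≡.≡-Reasoning
  open +-*-Solver
  pascal : ∀ a b → suc a C suc b ≡ a C b ℕ.+ a C suc b
  pascal a b = ≡.sym (nCk+nC[k+1]≡[n+1]C[k+1] a b)

p∣pCk : ∀ {p k} → Prime p → 0 < k → k < p → p ∣ p C k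
p∣pCk {suc n} {suc k} p-prime _ k<p
  with euclidsLemma (suc k) (suc n C suc k) p-prime
         (divides (n C k) (≡.trans ([1+k]*[1+n]C[1+k]≡[1+n]*nCk n k) (ℕ.*-comm (suc n) (n C k))))
... | inj₁ p∣1+k = ⊥-elim (ℕ.<⇒≱ k<p (∣⇒≤ p∣1+k))
... | inj₂ p∣pCk = p∣pCk

module _ {c ℓ} (R : CommutativeRing c ℓ) where
  open CommutativeRing R
  open import Algebra.Properties.Ring ring
    using (x+x≈x⇒x≈0; -0#≈0#; +-identityˡ-unique; +-inverseʳ-unique; ⁻¹-anti-homo‿-; xyx⁻¹≈y;
           -‿distribˡ-*; //-rightDividesˡ; //-rightDividesʳ)
  open import Algebra.Properties.CommutativeSemigroup +-commutativeSemigroup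
    using (interchange; xy∙z≈zx∙y)
  open import Relation.Binary.Reasoning.Setoid setoid

  homo-+⇒homo-0 : ∀ {f : Carrier → Carrier} → (∀ {x y} → x ≈ y → f x ≈ f y) →
                  (∀ x y → f (x + y) ≈ f x + f y) → f 0# ≈ 0#
  homo-+⇒homo-0 f-cong f-+ = x+x≈x⇒x≈0 _ (trans (sym (f-+ 0# 0#)) (f-cong (+-identityˡ 0#)))

  pow-cong : ∀ n {x y} → x ≈ y → pow R x n ≈ pow R y n
  pow-cong zero x≈y = refl
  pow-cong (suc n) x≈y = *-cong x≈y (pow-cong n x≈y)

  sum1to-cong : ∀ n {f g} → (∀ j → f j ≈ g j) → sum1to R n f ≈ sum1to R n g
  sum1to-cong zero f≈g = refl
  sum1to-cong (suc n) f≈g = +-cong (sum1to-cong n f≈g) (f≈g (suc n))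

  x-y≈z⇔x≈z+y : ∀ x y z → x - y ≈ z ⇔ x ≈ z + y
  x-y≈z⇔x≈z+y x y z = mk⇔ (λ x-y≈z → trans (sym (//-rightDividesˡ y x)) (+-congʳ x-y≈z))
                          (λ x≈z+y → trans (+-congʳ x≈z+y) (//-rightDividesʳ y z))

  sum1to-+ : ∀ n f g → sum1to R n (λ j → f j + g j) ≈ sum1to R n f + sum1to R n g
  sum1to-+ zero f g = sym (+-identityʳ 0#)
  sum1to-+ (suc n) f g = trans (+-congʳ (sum1to-+ n f g)) (interchange _ _ _ _)

  coeff-addP : ∀ F G n → coeff R (addP R F G) n ≈ coeff R F n + coeff R G n
  coeff-addP [] G n = sym (+-identityˡ _)
  coeff-addP (x ∷ F) [] zero = sym (+-identityʳ _)
  coeff-addP (x ∷ F) [] (suc n) = sym (+-identityʳ _)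
  coeff-addP (x ∷ F) (y ∷ G) zero = refl
  coeff-addP (x ∷ F) (y ∷ G) (suc n) = coeff-addP F G n

  coeff-map : ∀ {f} → f 0# ≈ 0# → ∀ F n → coeff R (map f F) n ≈ f (coeff R F n)
  coeff-map f0≈0 [] n = sym f0≈0
  coeff-map f0≈0 (x ∷ F) zero = refl
  coeff-map f0≈0 (x ∷ F) (suc n) = coeff-map f0≈0 F n

  coeff-sum1toP : ∀ m f n → coeff R (sum1toP R m f) n ≈ sum1to R m (λ j → coeff R (f j) n)
  coeff-sum1toP zero f n = refl
  coeff-sum1toP (suc m) f n =
    trans (coeff-addP (sum1toP R m f) (f (suc m)) n) (+-congʳ (coeff-sum1toP m f n))

  module Frobenius where
    open import Algebra.Properties.Semiring.Exp semiring using (^-assocʳ; ^-congˡ)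
      renaming (_^_ to _^ʳ_)
    open import Algebra.Properties.Semiring.Mult semiring using (_×_; ×-assoc-*; ×-congʳ)
    open import Algebra.Properties.Monoid.Mult +-monoid using (×-assocˡ; ×-homo-1)
    open import Algebra.Properties.Monoid.Sum +-monoid using (sum)
    open import Algebra.Properties.CommutativeSemiring.Binomial commutativeSemiring
      using (binomialExpansion; binomialTerm; theorem)

    pow≈^ : ∀ x n → pow R x n ≈ x ^ʳ n
    pow≈^ x zero = refl
    pow≈^ x (suc n) = *-congˡ (pow≈^ x n)

    n×1≈natToL : ∀ n → n × 1# ≈ natToL R n
    n×1≈natToL zero = refl
    n×1≈natToL (suc n) = +-congˡ (n×1≈natToL n)

    n×0≈0 : ∀ n → n × 0# ≈ 0#
    n×0≈0 zero = refl
    n×0≈0 (suc n) = trans (+-congˡ (n×0≈0 n)) (+-identityˡ 0#)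

    ×-vanishes : ∀ {p n} → natToL R p ≈ 0# → p ∣ n → ∀ x → n × x ≈ 0#
    ×-vanishes {p} char-p (divides d ≡.refl) x = begin
      (d ℕ.* p) × x          ≈⟨ sym (×-assocˡ x d p) ⟩
      d × (p × x)            ≈⟨ ×-congʳ d (×-congʳ p (sym (*-identityˡ x))) ⟩
      d × (p × (1# * x))     ≈⟨ ×-congʳ d (sym (×-assoc-* p 1# x)) ⟩
      d × ((p × 1#) * x)     ≈⟨ ×-congʳ d (*-congʳ (trans (n×1≈natToL p) char-p)) ⟩
      d × (0# * x)           ≈⟨ ×-congʳ d (zeroˡ x) ⟩
      d × 0#                 ≈⟨ n×0≈0 d ⟩
      0#                     ∎

    sum≈last : ∀ m (f : Fin (suc m) → Carrier) → (∀ i → toℕ i < m → f i ≈ 0#) →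
               sum f ≈ f (fromℕ m)
    sum≈last zero f _ = +-identityʳ _
    sum≈last (suc m) f f≈0 =
      trans (+-cong (f≈0 Fin.zero (s≤s z≤n))
                    (sum≈last m (f ∘ Fin.suc) (λ i i<m → f≈0 (Fin.suc i) (s≤s i<m))))
            (+-identityˡ _)

    ^[1+m]-homo-+ : ∀ m x y → (∀ i → toℕ i < m → binomialTerm x y (suc m) (Fin.suc i) ≈ 0#) →
                    (x + y) ^ʳ suc m ≈ x ^ʳ suc m + y ^ʳ suc m
    ^[1+m]-homo-+ m x y middle≈0 = begin
      (x + y) ^ʳ suc m                   ≈⟨ theorem (suc m) x y ⟩
      binomialExpansion x y (suc m)
        ≈⟨ +-cong first (trans (sum≈last m _ middle≈0) (last _ (toℕ-fromℕ m))) ⟩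
      y ^ʳ suc m + x ^ʳ suc m            ≈⟨ +-comm _ _ ⟩
      x ^ʳ suc m + y ^ʳ suc m            ∎
      where
      first : binomialTerm x y (suc m) Fin.zero ≈ y ^ʳ suc m
      first = trans (×-homo-1 _) (*-identityˡ _)
      last : ∀ j → j ≡ m → (suc m C suc j) × (x ^ʳ suc j * y ^ʳ (m ℕ.∸ j)) ≈ x ^ʳ suc m
      last j ≡.refl rewrite nCn≡1 (suc j) | ℕ.n∸n≡0 j = trans (×-homo-1 _) (*-identityʳ _)

    ^p-homo-+ : ∀ {p} → Prime p → natToL R p ≈ 0# → ∀ x y → (x + y) ^ʳ p ≈ x ^ʳ p + y ^ʳ p
    ^p-homo-+ {zero} ()
    ^p-homo-+ {suc m} p-prime char-p x y = ^[1+m]-homo-+ m x y λ i i<m →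
      ×-vanishes char-p (p∣pCk p-prime (s≤s z≤n) (s≤s i<m)) _

    ^[p^k]-homo-+ : ∀ {p} → Prime p → natToL R p ≈ 0# →
                    ∀ k x y → (x + y) ^ʳ (p ^ k) ≈ x ^ʳ (p ^ k) + y ^ʳ (p ^ k)
    ^[p^k]-homo-+ p-prime char-p zero x y = trans (*-identityʳ _) (sym (+-cong (*-identityʳ x) (*-identityʳ y)))
    ^[p^k]-homo-+ {p} p-prime char-p (suc k) x y = begin
      (x + y) ^ʳ (p ℕ.* p ^ k)                      ≈⟨ sym (^-assocʳ (x + y) p (p ^ k)) ⟩
      ((x + y) ^ʳ p) ^ʳ (p ^ k)                     ≈⟨ ^-congˡ (p ^ k) (^p-homo-+ p-prime char-p x y) ⟩
      (x ^ʳ p + y ^ʳ p) ^ʳ (p ^ k)                  ≈⟨ ^[p^k]-homo-+ p-prime char-p k (x ^ʳ p) (y ^ʳ p) ⟩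
      (x ^ʳ p) ^ʳ (p ^ k) + (y ^ʳ p) ^ʳ (p ^ k)     ≈⟨ +-cong (^-assocʳ x p (p ^ k)) (^-assocʳ y p (p ^ k)) ⟩
      x ^ʳ (p ℕ.* p ^ k) + y ^ʳ (p ℕ.* p ^ k)       ∎

    pow-[q^j]-homo-+ : ∀ {p e q} → Prime p → natToL R p ≈ 0# → q ≡ p ^ e →
                       ∀ j x y → pow R (x + y) (q ^ j) ≈ pow R x (q ^ j) + pow R y (q ^ j)
    pow-[q^j]-homo-+ {p} {e} p-prime char-p ≡.refl j x y rewrite ℕ.^-*-assoc p e j = begin
      pow R (x + y) N         ≈⟨ pow≈^ (x + y) N ⟩
      (x + y) ^ʳ N            ≈⟨ ^[p^k]-homo-+ p-prime char-p (e ℕ.* j) x y ⟩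
      x ^ʳ N + y ^ʳ N         ≈⟨ sym (+-cong (pow≈^ x N) (pow≈^ y N)) ⟩
      pow R x N + pow R y N   ∎
      where N = p ^ (e ℕ.* j)

  module Action (φ : Carrier → Carrier)
    (φ-cong : ∀ {x y} → x ≈ y → φ x ≈ φ y) (φ-+ : ∀ x y → φ (x + y) ≈ φ x + φ y) where

    φ-0 : φ 0# ≈ 0#
    φ-0 = homo-+⇒homo-0 φ-cong φ-+

    φ-neg : ∀ x → φ (- x) ≈ - φ x
    φ-neg x = +-inverseʳ-unique (φ x) (φ (- x))
      (trans (sym (φ-+ x (- x))) (trans (φ-cong (-‿inverseʳ x)) φ-0))

    act : Poly R → Carrier
    act [] = 0#
    act (x ∷ F) = x + φ (act F)

    act-zero : ∀ F → _≈ₚ_ R F [] → act F ≈ 0#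
    act-zero [] _ = refl
    act-zero (x ∷ F) F≈0 =
      trans (+-cong (F≈0 0) (trans (φ-cong (act-zero F (F≈0 ∘ suc))) φ-0)) (+-identityˡ 0#)

    act-cong : ∀ F G → _≈ₚ_ R F G → act F ≈ act G
    act-cong [] G F≈G = sym (act-zero G (sym ∘ F≈G))
    act-cong (x ∷ F) [] F≈G = act-zero (x ∷ F) F≈G
    act-cong (x ∷ F) (y ∷ G) F≈G = +-cong (F≈G 0) (φ-cong (act-cong F G (F≈G ∘ suc)))

    act-addP : ∀ F G → act (addP R F G) ≈ act F + act G
    act-addP [] G = sym (+-identityˡ _)
    act-addP (x ∷ F) [] = sym (+-identityʳ _)
    act-addP (x ∷ F) (y ∷ G) = begin
      (x + y) + φ (act (addP R F G))      ≈⟨ +-congˡ (trans (φ-cong (act-addP F G)) (φ-+ _ _)) ⟩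
      (x + y) + (φ (act F) + φ (act G))   ≈⟨ interchange _ _ _ _ ⟩
      (x + φ (act F)) + (y + φ (act G))   ∎

    act-map : ∀ G → act (map φ G) ≈ φ (act G)
    act-map [] = sym φ-0
    act-map (x ∷ G) = trans (+-congˡ (φ-cong (act-map G))) (sym (φ-+ x (φ (act G))))

    Telescoping : Poly R → Poly R → Set ℓ
    Telescoping F g = ∀ n → coeff R F n + coeff R (shiftP R g) n ≈ φ (coeff R g n)

    telescoping⇒act≈0 : ∀ F g → Telescoping F g → act F ≈ 0#
    telescoping⇒act≈0 F g tel = +-identityˡ-unique (act F) (φ (act g)) (begin
      act F + φ (act g)              ≈⟨ +-congˡ (sym (+-identityˡ _)) ⟩
      act F + act (shiftP R g)       ≈⟨ sym (act-addP F (shiftP R g)) ⟩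
      act (addP R F (shiftP R g))    ≈⟨ act-cong (addP R F (shiftP R g)) (map φ g) F+tg≈φg ⟩
      act (map φ g)                  ≈⟨ act-map g ⟩
      φ (act g)                      ∎)
      where
      F+tg≈φg : _≈ₚ_ R (addP R F (shiftP R g)) (map φ g)
      F+tg≈φg n = trans (coeff-addP F (shiftP R g) n) (trans (tel n) (sym (coeff-map φ-0 g n)))

    negTails : Poly R → Poly R
    negTails [] = []
    negTails (x ∷ F) = - act F ∷ negTails F

    coeff-negTails : ∀ F n → coeff R F n + coeff R (- act F ∷ negTails F) n ≈ φ (coeff R (negTails F) n)
    coeff-negTails [] zero = trans (+-identityˡ _) (trans -0#≈0# (sym φ-0))
    coeff-negTails [] (suc n) = trans (+-identityˡ _) (sym φ-0)
    coeff-negTails (x ∷ F) zero = begin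
      x - (x + φ (act F))       ≈⟨ sym (⁻¹-anti-homo‿- (x + φ (act F)) x) ⟩
      - ((x + φ (act F)) - x)   ≈⟨ -‿cong (xyx⁻¹≈y x (φ (act F))) ⟩
      - φ (act F)               ≈⟨ sym (φ-neg (act F)) ⟩
      φ (- act F)               ∎
    coeff-negTails (x ∷ F) (suc n) = coeff-negTails F n

    act≈0⇒telescoping : ∀ F → act F ≈ 0# → Telescoping F (negTails F)
    act≈0⇒telescoping F act≈0 zero =
      trans (+-congˡ (sym (trans (-‿cong act≈0) -0#≈0#))) (coeff-negTails F 0)
    act≈0⇒telescoping F act≈0 (suc n) = coeff-negTails F (suc n)

    act≈0⇔telescoping : ∀ F → act F ≈ 0# ⇔ ∃ (Telescoping F)
    act≈0⇔telescoping F = mk⇔ (λ act≈0 → negTails F , act≈0⇒telescoping F act≈0)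
                              (λ (g , tel) → telescoping⇒act≈0 F g tel)

  module DrinfeldModule (q : ℕ) (θ : Carrier) (r : ℕ) (κ : ℕ → Carrier)
    (pow-+ : ∀ j x y → pow R (x + y) (q ^ j) ≈ pow R x (q ^ j) + pow R y (q ^ j)) where

    φₜ : Carrier → Carrier
    φₜ = phiT R q θ r κ

    twist-sum : Carrier → Carrier
    twist-sum x = sum1to R r (λ j → κ j * pow R x (q ^ j))

    φₜ-cong : ∀ {x y} → x ≈ y → φₜ x ≈ φₜ y
    φₜ-cong x≈y = +-cong (*-congˡ x≈y) (sum1to-cong r (λ j → *-congˡ (pow-cong (q ^ j) x≈y)))

    φₜ-+ : ∀ x y → φₜ (x + y) ≈ φₜ x + φₜ y
    φₜ-+ x y = begin
      θ * (x + y) + twist-sum (x + y)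
        ≈⟨ +-cong (distribˡ θ x y)
                  (trans (sum1to-cong r (λ j → trans (*-congˡ (pow-+ j x y)) (distribˡ (κ j) _ _)))
                         (sum1to-+ r _ _)) ⟩
      (θ * x + θ * y) + (twist-sum x + twist-sum y)   ≈⟨ interchange _ _ _ _ ⟩
      φₜ x + φₜ y                                     ∎

    open Action φₜ φₜ-cong φₜ-+ public using (act; act-addP; Telescoping; act≈0⇔telescoping)

    phiA≈act : ∀ a x → phiA R q θ r κ a x ≈ act (scaleP R x a)
    phiA≈act [] x = refl
    phiA≈act (a₀ ∷ a) x = +-cong (*-comm a₀ x) (φₜ-cong (phiA≈act a x))

    sumFin-phiA≈act : ∀ n (P : Fin n → Carrier) (a : Fin n → Poly R) →
      sumFin R (λ i → phiA R q θ r κ (a i) (P i)) ≈ act (sumFinP R (λ i → scaleP R (P i) (a i)))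
    sumFin-phiA≈act zero P a = refl
    sumFin-phiA≈act (suc n) P a = trans
      (+-cong (phiA≈act (a Fin.zero) (P Fin.zero)) (sumFin-phiA≈act n (P ∘ Fin.suc) (a ∘ Fin.suc)))
      (sym (act-addP (scaleP R (P Fin.zero) (a Fin.zero)) _))

    pointwise-equation⇔telescoping : ∀ s x f → (s + (- θ) * x) + f ≈ twist-sum x ⇔ f + s ≈ φₜ x
    pointwise-equation⇔telescoping s x f = mk⇔
      (λ eq → trans (to (x-y≈z⇔x≈z+y _ _ _) (trans (sym reorder) eq)) (+-comm _ _))
      (λ eq → trans reorder (from (x-y≈z⇔x≈z+y _ _ _) (trans eq (+-comm _ _))))
      where
      open Equivalence
      reorder : (s + (- θ) * x) + f ≈ (f + s) - θ * x
      reorder = trans (xy∙z≈zx∙y s _ f) (+-congˡ (sym (-‿distribˡ-* θ x)))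

    equation⇔telescoping : ∀ F g →
      _≈ₚ_ R (addP R (addP R (shiftP R g) (scaleP R (- θ) g)) F)
             (sum1toP R r (λ j → scaleP R (κ j) (twistP R q j g)))
      ⇔ Telescoping F g
    equation⇔telescoping F g = mk⇔
      (λ eq n → to (pointwise-equation⇔telescoping _ _ _) (trans (sym (lhs n)) (trans (eq n) (rhs n))))
      (λ tel n → trans (lhs n) (trans (from (pointwise-equation⇔telescoping _ _ _) (tel n)) (sym (rhs n))))
      where
      open Equivalence
      lhs : ∀ n → coeff R (addP R (addP R (shiftP R g) (scaleP R (- θ) g)) F) n
                ≈ (coeff R (shiftP R g) n + (- θ) * coeff R g n) + coeff R F n
      lhs n = trans (coeff-addP (addP R (shiftP R g) (scaleP R (- θ) g)) F n)
                    (+-congʳ (trans (coeff-addP (shiftP R g) (scaleP R (- θ) g) n)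
                                    (+-congˡ (coeff-map {f = (- θ) *_} (zeroʳ (- θ)) g n))))
      rhs : ∀ n → coeff R (sum1toP R r (λ j → scaleP R (κ j) (twistP R q j g))) n
                ≈ twist-sum (coeff R g n)
      rhs n = trans (coeff-sum1toP r _ n) (sum1to-cong r λ j →
        trans (coeff-map (zeroʳ (κ j)) (twistP R q j g) n)
              (*-congˡ (coeff-map (homo-+⇒homo-0 (pow-cong (q ^ j)) (pow-+ j)) g n)))

lemma3p1 : ∀ {c ℓ} (L : CommutativeRing c ℓ) → let open CommutativeRing L in
    IsField L →
    (p e q : ℕ) → Prime p → q ≡ p ^ suc e → natToL L p ≈ 0# → ContainsFq L q →
    (θ : Carrier) → Transcendental L q θ → FiniteOverFqθ L q θ →
    (r : ℕ) → 1 ≤ r → (κ : ℕ → Carrier) → ¬ (κ r ≈ 0#) →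
    (n : ℕ) (P : Fin n → Carrier) (a : Fin n → Poly L) → (∀ i → FqPoly L q (a i)) →
    (sumFin L (λ i → phiA L q θ r κ (a i) (P i)) ≈ 0#)
      ⇔
    (∃ λ (g : Poly L) →
      _≈ₚ_ L (addP L (addP L (shiftP L g) (scaleP L (- θ) g))
                    (sumFinP L (λ i → scaleP L (P i) (a i))))
             (sum1toP L r (λ j → scaleP L (κ j) (twistP L q j g))))
lemma3p1 L _ p e q p-prime q≡p^[1+e] char-p _ θ _ _ r _ κ _ n P a _ =
  mk⇔ (λ Σφ≈0 → map₂ (from (equation⇔telescoping F _))
                      (to (act≈0⇔telescoping F) (trans (sym (sumFin-phiA≈act n P a)) Σφ≈0)))
      (λ (g , eq) → trans (sumFin-phiA≈act n P a)
                          (from (act≈0⇔telescoping F) (g , to (equation⇔telescoping F g) eq)))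
  where
  open CommutativeRing L
  open Equivalence
  open DrinfeldModule L q θ r κ (Frobenius.pow-[q^j]-homo-+ L {e = suc e} p-prime char-p q≡p^[1+e])
  F : Poly L
  F = sumFinP L (λ i → scaleP L (P i) (a i))
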